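{- Let $S$ be a 1--signature. The assignments $Q\mapsto\Delta Q$ (from representations of $S$ in endomonads on $\mathbf{Set}$ to representations of $S$ in relative monads on $\Delta$) and $R\mapsto\bar R$ (in the other direction) extend to functors $\Delta:\mathrm{Rep}(S)\to\mathrm{Rep}^\Delta(S)$ and $U:\mathrm{Rep}^\Delta(S)\to\mathrm{Rep}(S)$ forming an adjunction $\Delta\dashv U$, i.e. there are bijections, natural in $P\in\mathrm{Rep}(S)$ and $Q\in\mathrm{Rep}^\Delta(S)$, $$\mathrm{Rep}^\Delta(S)(\Delta P,Q)\cong\mathrm{Rep}(S)(P,\bar Q).$$
   Context: $\Delta:\mathbf{Set}\to\mathbf{PO}$ sends $X$ to $(X,=)$; it is left adjoint to the forgetful functor $U:\mathbf{PO}\to\mathbf{Set}$. A relative monad $P$ on a functor $F:\mathcal C\to\mathcal D$ consists of an object map $P$, morphisms $\eta_c:Fc\to Pc$, and substitution maps $\sigma_{c,d}:\mathcal D(Fc,Pd)\to\mathcal D(Pc,Pd)$ with $\sigma(f)\circ\eta_c=f$, $\sigma(\eta_c)=\mathrm{id}$, $\sigma(g)\circ\sigma(f)=\sigma(\sigma(g)\circ f)$; an endomonad on $\mathbf{Set}$ is a relative monad on $\mathrm{Id}_{\mathbf{Set}}$. Monad morphisms $\tau:P\to Q$ satisfy $\tau_d\circ\sigma^P(f)=\sigma^Q(\tau_d\circ f)\circ\tau_c$ and $\tau\circ\eta^P=\eta^Q$. Modules over $P$ with codomain $\mathcal E$: object map $M$ with $\varsigma_{c,d}:\mathcal D(Fc,Pd)\to\mathcal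 E(Mc,Md)$, $\varsigma(g)\circ\varsigma(f)=\varsigma(\sigma(g)\circ f)$, $\varsigma(\eta)=\mathrm{id}$; module morphisms commute with $\varsigma$. Tautological module, pullback along monad morphisms ($\varsigma^{h^*M}(f)=\varsigma^M(h\circ f)$), pointwise products, and derivation $M'(V)=M(V+\{*\})$ with substitution through the shifted map (sending $*$ to $\eta(*)$ and $v$ to the renaming of $f(v)$ along $W\subseteq W+\{*\}$) are defined for monads on $\Delta$ and on $\mathrm{Id}_{\mathbf{Set}}$. For an arity $s=[n_1,\dots,n_m]$ (list of naturals), $M^s=M^{n_1}\times\dots\times M^{n_m}$ with $M^n$ the $n$-fold derivative. For a 1--signature $S$ (a family of arities), $\mathrm{Rep}^\Delta(S)$ has objects: a monad $R$ on $\Delta$ with an $R$--module morphism (codomain $\mathbf{PO}$) $s^R:R^s\to R$ for each $s\in S$; morphisms: monad morphisms $f$ with $f\circ s^P=f^*(s^Q)\circ f^s$. $\mathrm{Rep}(S)$ (Hirschowitz–Maggesi) is defined identically with endomonads on $\mathbf{Set}$ and modules with codomain $\mathbf{Set}$. For $R\in\mathrm{Rep}^\Delta(S)$, $\bar R$ is the endomonad $X\mapsto U(RX)$ with unit $\eta_X$ and substitution $\sigma^{\bar R}(f)=U(\sigma^R(f))$ (a function $X\to U(RY)$ is the same as a monotone map $\Delta X\to RY$), with representation morphisms $U\circ s^R$. For an endomonad representation $Q$, $\Delta Q$ is the relative monad $X\mapsto\Delta(QX)$ with the same unit and substitution, and representation morphisms $\Delta(s^Q)$. -}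

module Defs where

open import Data.Nat using (ℕ; zero; suc)
open import Data.List using (List; []; _∷_)
open import Data.Product using (Σ; _×_; _,_; proj₁; proj₂)
open import Data.Sum using (_⊎_; inj₁; inj₂)
open import Data.Unit using (⊤; tt)
open import Function using (_∘_)
open import Relation.Binary.PropositionalEquality

record PO : Set₁ where
  field
    Car     : Set
    _⊑_     : Car → Car → Set
    ⊑-refl  : ∀ {x} → x ⊑ x
    ⊑-trans : ∀ {x y z} → x ⊑ y → y ⊑ z → x ⊑ z
open PO public using (Car)

infixr 1 _⇒_
record _⇒_ (A B : PO) : Set where
  field
    fun  : Car A → Car B
    mono : ∀ {x y} → PO._⊑_ A x y → PO._⊑_ B (fun x) (fun y)
open _⇒_ public

Δ : Set → PO
Δ X = record { Car = X ; _⊑_ = _≡_ ; ⊑-refl = refl ; ⊑-trans = trans }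

⊤PO : PO
⊤PO = record { Car = ⊤ ; _⊑_ = λ _ _ → ⊤ ; ⊑-refl = tt ; ⊑-trans = λ _ _ → tt }

_×PO_ : PO → PO → PO
A ×PO B = record
  { Car = Car A × Car B
  ; _⊑_ = λ p q → PO._⊑_ A (proj₁ p) (proj₁ q) × PO._⊑_ B (proj₂ p) (proj₂ q)
  ; ⊑-refl = PO.⊑-refl A , PO.⊑-refl B
  ; ⊑-trans = λ p q → PO.⊑-trans A (proj₁ p) (proj₁ q) , PO.⊑-trans B (proj₂ p) (proj₂ q)
  }

ext : ℕ → Set → Set
ext zero    X = X
ext (suc n) X = ext n (X ⊎ ⊤)

module Kit (T : Set → Set) (η : ∀ {X : Set} → X → T X)
           (bind : ∀ {X Y : Set} → (X → T Y) → T X → T Y) where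

  shift : ∀ {X Y : Set} → (X → T Y) → X ⊎ ⊤ → T (Y ⊎ ⊤)
  shift f (inj₁ x) = bind ((λ y → η (inj₁ y))) (f x)
  shift f (inj₂ _) = η (inj₂ tt)

  shiftN : ∀ n {X Y : Set} → (X → T Y) → ext n X → T (ext n Y)
  shiftN zero    f = f
  shiftN (suc n) f = shiftN n (shift f)

  module Laws
    (bind-cong : ∀ {X Y} {f g : X → T Y} → (∀ x → f x ≡ g x) → ∀ t → bind f t ≡ bind g t)
    (bind-η-r  : ∀ {X Y} (f : X → T Y) x → bind f (η x) ≡ f x)
    (bind-η    : ∀ {X : Set} (t : T X) → bind η t ≡ t)
    (bind-bind : ∀ {X Y Z : Set} (f : X → T Y) (g : Y → T Z) t → bind g (bind f t) ≡ bind (bind g ∘ f) t)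
    where

    shift-cong : ∀ {X Y} {f g : X → T Y} → (∀ x → f x ≡ g x) → ∀ z → shift f z ≡ shift g z
    shift-cong e (inj₁ x) = cong (bind ((λ y → η (inj₁ y)))) (e x)
    shift-cong e (inj₂ _) = refl

    shiftN-cong : ∀ n {X Y : Set} {f g : X → T Y} → (∀ x → f x ≡ g x) → ∀ z → shiftN n f z ≡ shiftN n g z
    shiftN-cong zero    e = e
    shiftN-cong (suc n) e = shiftN-cong n (shift-cong e)

    shift-η : ∀ {X : Set} (z : X ⊎ ⊤) → shift η z ≡ η z
    shift-η (inj₁ x) = bind-η-r ((λ y → η (inj₁ y))) x
    shift-η (inj₂ _) = refl

    shiftN-η : ∀ n {X : Set} (z : ext n X) → shiftN n η z ≡ η z
    shiftN-η zero    z = refl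
    shiftN-η (suc n) z = trans (shiftN-cong n shift-η z) (shiftN-η n z)

    shift-bind : ∀ {X Y Z : Set} (f : X → T Y) (g : Y → T Z) z →
                 bind (shift g) (shift f z) ≡ shift (bind g ∘ f) z
    shift-bind f g (inj₁ x) =
      trans (bind-bind ((λ y → η (inj₁ y))) (shift g) (f x))
      (trans (bind-cong (λ y → bind-η-r (shift g) (inj₁ y)) (f x))
             (sym (bind-bind g ((λ y → η (inj₁ y))) (f x))))
    shift-bind f g (inj₂ _) = bind-η-r (shift g) (inj₂ tt)

    shiftN-bind : ∀ n {X Y Z} (f : X → T Y) (g : Y → T Z) z →
                  bind (shiftN n g) (shiftN n f z) ≡ shiftN n (bind g ∘ f) z
    shiftN-bind zero    f g z = refl
    shiftN-bind (suc n) f g z =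
      trans (shiftN-bind n (shift f) (shift g) z)
            (shiftN-cong n (shift-bind f g) z)

module KitMor (T₁ : Set → Set) (η₁ : ∀ {X : Set} → X → T₁ X)
              (bind₁ : ∀ {X Y : Set} → (X → T₁ Y) → T₁ X → T₁ Y)
              (T₂ : Set → Set) (η₂ : ∀ {X : Set} → X → T₂ X)
              (bind₂ : ∀ {X Y : Set} → (X → T₂ Y) → T₂ X → T₂ Y)
              (bind₂-cong : ∀ {X Y} {f g : X → T₂ Y} → (∀ x → f x ≡ g x) → ∀ t → bind₂ f t ≡ bind₂ g t)
              (τ : ∀ {X : Set} → T₁ X → T₂ X)
              (τ-bind : ∀ {X Y} (f : X → T₁ Y) t → τ (bind₁ f t) ≡ bind₂ (τ ∘ f) (τ t))
              (τ-η : ∀ {X : Set} (x : X) → τ (η₁ x) ≡ η₂ x) where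
  module K₁ = Kit T₁ η₁ bind₁
  module K₂ = Kit T₂ η₂ bind₂

  shiftN₂-cong : ∀ n {X Y : Set} {f g : X → T₂ Y} → (∀ x → f x ≡ g x) → ∀ z → K₂.shiftN n f z ≡ K₂.shiftN n g z
  shiftN₂-cong zero    e = e
  shiftN₂-cong (suc n) e = shiftN₂-cong n sc
    where
    sc : ∀ z → _
    sc (inj₁ x) = cong (bind₂ ((λ y → η₂ (inj₁ y)))) (e x)
    sc (inj₂ _) = refl

  τ-shift : ∀ {X Y} (f : X → T₁ Y) z → τ (K₁.shift f z) ≡ K₂.shift (τ ∘ f) z
  τ-shift f (inj₁ x) = trans (τ-bind ((λ y → η₁ (inj₁ y))) (f x)) (bind₂-cong (λ y → τ-η (inj₁ y)) (τ (f x)))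
  τ-shift f (inj₂ _) = τ-η (inj₂ tt)

  τ-shiftN : ∀ n {X Y : Set} (f : X → T₁ Y) z → τ (K₁.shiftN n f z) ≡ K₂.shiftN n (τ ∘ f) z
  τ-shiftN zero    f z = refl
  τ-shiftN (suc n) f z = trans (τ-shiftN n (K₁.shift f) z) (shiftN₂-cong n (τ-shift f) z)

-- Endomonads on Set (Kleisli-triple presentation, i.e. relative monads
-- on Id_Set).  σ-cong records that σ respects pointwise equality of
-- substitutions (automatic set-theoretically; needed without funext).

record Monad : Set₁ where
  field
    T     : Set → Set
    η     : ∀ {X : Set} → X → T X
    σ     : ∀ {X Y : Set} → (X → T Y) → T X → T Y
    σ-cong : ∀ {X Y : Set} {f g : X → T Y} → (∀ x → f x ≡ g x) → ∀ t → σ f t ≡ σ g t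
    σ-η-r : ∀ {X Y : Set} (f : X → T Y) x → σ f (η x) ≡ f x
    σ-η   : ∀ {X : Set} (t : T X) → σ η t ≡ t
    σ-σ   : ∀ {X Y Z : Set} (f : X → T Y) (g : Y → T Z) t → σ g (σ f t) ≡ σ (σ g ∘ f) t

record MonadMor (P Q : Monad) : Set₁ where
  private
    module P = Monad P
    module Q = Monad Q
  field
    τ   : ∀ X → P.T X → Q.T X
    τ-σ : ∀ {X Y : Set} (f : X → P.T Y) t → τ Y (P.σ f t) ≡ Q.σ (τ Y ∘ f) (τ X t)
    τ-η : ∀ {X : Set} (x : X) → τ X (P.η x) ≡ Q.η x

idMonadMor : (P : Monad) → MonadMor P P
idMonadMor P = record { τ = λ X t → t ; τ-σ = λ f t → refl ; τ-η = λ x → refl }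

compMonadMor : {P Q R : Monad} → MonadMor Q R → MonadMor P Q → MonadMor P R
compMonadMor {P} {Q} {R} g f = record
  { τ = λ X t → G.τ X (F.τ X t)
  ; τ-σ = λ h t → trans (cong (G.τ _) (F.τ-σ h t)) (G.τ-σ (F.τ _ ∘ h) (F.τ _ t))
  ; τ-η = λ x → trans (cong (G.τ _) (F.τ-η x)) (G.τ-η x)
  }
  where
  module G = MonadMor g
  module F = MonadMor f

module MonadKit (P : Monad) where
  open Monad P
  open Kit T η σ public
  open Laws σ-cong σ-η-r σ-η σ-σ public

record Mod (P : Monad) : Set₁ where
  open Monad P
  field
    M     : Set → Set
    ς     : ∀ {X Y : Set} → (X → T Y) → M X → M Y
    ς-cong : ∀ {X Y : Set} {f g : X → T Y} → (∀ x → f x ≡ g x) → ∀ m → ς f m ≡ ς g m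
    ς-η   : ∀ {X : Set} (m : M X) → ς η m ≡ m
    ς-σ   : ∀ {X Y Z : Set} (f : X → T Y) (g : Y → T Z) m → ς g (ς f m) ≡ ς (σ g ∘ f) m

record ModMor {P : Monad} (M N : Mod P) : Set₁ where
  open Monad P
  private
    module M = Mod M
    module N = Mod N
  field
    ρ     : ∀ X → M.M X → N.M X
    ρ-nat : ∀ {X Y : Set} (f : X → T Y) m → ρ Y (M.ς f m) ≡ N.ς f (ρ X m)

_≈Mod_ : {P : Monad} {M N : Mod P} → ModMor M N → ModMor M N → Set₁
_≈Mod_ {M = M} a b = ∀ X (m : Mod.M M X) → ModMor.ρ a X m ≡ ModMor.ρ b X m

compMod : {P : Monad} {L M N : Mod P} → ModMor M N → ModMor L M → ModMor L N
compMod {L = L} {M} {N} b a = record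
  { ρ = λ X m → B.ρ X (A.ρ X m)
  ; ρ-nat = λ f m → trans (cong (B.ρ _) (A.ρ-nat f m)) (B.ρ-nat f (A.ρ _ m))
  }
  where
  module A = ModMor a
  module B = ModMor b

taut : (P : Monad) → Mod P
taut P = record
  { M = T ; ς = σ ; ς-cong = σ-cong ; ς-η = σ-η ; ς-σ = σ-σ }
  where open Monad P

pull : {P Q : Monad} → MonadMor P Q → Mod Q → Mod P
pull {P} {Q} h N = record
  { M = N.M
  ; ς = λ f → N.ς (H.τ _ ∘ f)
  ; ς-cong = λ e → N.ς-cong (λ x → cong (H.τ _) (e x))
  ; ς-η = λ m → trans (N.ς-cong H.τ-η m) (N.ς-η m)
  ; ς-σ = λ f g m → trans (N.ς-σ (H.τ _ ∘ f) (H.τ _ ∘ g) m)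
                         (N.ς-cong (λ x → sym (H.τ-σ g (f x))) m)
  }
  where
  module N = Mod N
  module H = MonadMor h

pullMor : {P Q : Monad} (h : MonadMor P Q) {M N : Mod Q} → ModMor M N → ModMor (pull h M) (pull h N)
pullMor h a = record { ρ = ModMor.ρ a ; ρ-nat = λ f m → ModMor.ρ-nat a _ m }

tautMor : {P Q : Monad} (h : MonadMor P Q) → ModMor (taut P) (pull h (taut Q))
tautMor h = record { ρ = MonadMor.τ h ; ρ-nat = MonadMor.τ-σ h }

derivN : {P : Monad} → ℕ → Mod P → Mod P
derivN {P} n N = record
  { M = λ X → N.M (ext n X)
  ; ς = λ f → N.ς (shiftN n f)
  ; ς-cong = λ e → N.ς-cong (shiftN-cong n e)
  ; ς-η = λ m → trans (N.ς-cong (shiftN-η n) m) (N.ς-η m)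
  ; ς-σ = λ f g m → trans (N.ς-σ (shiftN n f) (shiftN n g) m) (N.ς-cong (shiftN-bind n f g) m)
  }
  where
  module N = Mod N
  open MonadKit P

oneMod : {P : Monad} → Mod P
oneMod = record { M = λ _ → ⊤ ; ς = λ _ _ → tt ; ς-cong = λ _ _ → refl ; ς-η = λ _ → refl ; ς-σ = λ _ _ _ → refl }

_×Mod_ : {P : Monad} → Mod P → Mod P → Mod P
A ×Mod B = record
  { M = λ X → A.M X × B.M X
  ; ς = λ f p → A.ς f (proj₁ p) , B.ς f (proj₂ p)
  ; ς-cong = λ e p → cong₂ _,_ (A.ς-cong e (proj₁ p)) (B.ς-cong e (proj₂ p))
  ; ς-η = λ p → cong₂ _,_ (A.ς-η (proj₁ p)) (B.ς-η (proj₂ p))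
  ; ς-σ = λ f g p → cong₂ _,_ (A.ς-σ f g (proj₁ p)) (B.ς-σ f g (proj₂ p))
  }
  where
  module A = Mod A
  module B = Mod B

Arity : Set
Arity = List ℕ

pow : {P : Monad} → Mod P → Arity → Mod P
pow N []      = oneMod
pow N (n ∷ s) = derivN n N ×Mod pow N s

powMor : {P Q : Monad} (h : MonadMor P Q) (s : Arity) → ModMor (pow (taut P) s) (pull h (pow (taut Q) s))
powMor h [] = record { ρ = λ _ _ → tt ; ρ-nat = λ _ _ → refl }
powMor {P} {Q} h (n ∷ s) = record
  { ρ = λ X p → H.τ (ext n X) (proj₁ p) , ModMor.ρ rest X (proj₂ p)
  ; ρ-nat = λ f p → cong₂ _,_
      (trans (H.τ-σ (MonadKit.shiftN P n f) (proj₁ p))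
             (Q.σ-cong (KM.τ-shiftN n f) (H.τ _ (proj₁ p))))
      (ModMor.ρ-nat rest f (proj₂ p))
  }
  where
  module H = MonadMor h
  module P = Monad P
  module Q = Monad Q
  rest = powMor h s
  module KM = KitMor P.T P.η P.σ Q.T Q.η Q.σ Q.σ-cong (H.τ _) H.τ-σ H.τ-η

-- Relative monads on Δ : Set → PO.
-- A morphism Δ X → T Y in PO is the same as a function X → Car (T Y);
-- we use the latter for η and for the arguments of σ.

record RMonad : Set₁ where
  field
    T     : Set → PO
    η     : ∀ {X : Set} → X → Car (T X)
    σ     : ∀ {X Y : Set} → (X → Car (T Y)) → T X ⇒ T Y
    σ-cong : ∀ {X Y : Set} {f g : X → Car (T Y)} → (∀ x → f x ≡ g x) → ∀ t → fun (σ f) t ≡ fun (σ g) t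
    σ-η-r : ∀ {X Y : Set} (f : X → Car (T Y)) x → fun (σ f) (η x) ≡ f x
    σ-η   : ∀ {X : Set} (t : Car (T X)) → fun (σ η) t ≡ t
    σ-σ   : ∀ {X Y Z : Set} (f : X → Car (T Y)) (g : Y → Car (T Z)) t →
            fun (σ g) (fun (σ f) t) ≡ fun (σ (fun (σ g) ∘ f)) t

record RMonadMor (P Q : RMonad) : Set₁ where
  private
    module P = RMonad P
    module Q = RMonad Q
  field
    τ   : ∀ X → P.T X ⇒ Q.T X
    τ-σ : ∀ {X Y : Set} (f : X → Car (P.T Y)) t →
          fun (τ Y) (fun (P.σ f) t) ≡ fun (Q.σ (fun (τ Y) ∘ f)) (fun (τ X) t)
    τ-η : ∀ {X : Set} (x : X) → fun (τ X) (P.η x) ≡ Q.η x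

idRMonadMor : (P : RMonad) → RMonadMor P P
idRMonadMor P = record
  { τ = λ X → record { fun = λ t → t ; mono = λ le → le }
  ; τ-σ = λ f t → refl ; τ-η = λ x → refl }

compRMonadMor : {P Q R : RMonad} → RMonadMor Q R → RMonadMor P Q → RMonadMor P R
compRMonadMor {P} {Q} {R} g f = record
  { τ = λ X → record { fun = λ t → fun (G.τ X) (fun (F.τ X) t)
                     ; mono = λ le → mono (G.τ X) (mono (F.τ X) le) }
  ; τ-σ = λ h t → trans (cong (fun (G.τ _)) (F.τ-σ h t)) (G.τ-σ (fun (F.τ _) ∘ h) (fun (F.τ _) t))
  ; τ-η = λ x → trans (cong (fun (G.τ _)) (F.τ-η x)) (G.τ-η x)
  }
  where
  module G = RMonadMor g
  module F = RMonadMor f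

module RMonadKit (P : RMonad) where
  open RMonad P
  open Kit (λ X → Car (T X)) η (λ f → fun (σ f)) public
  open Laws σ-cong σ-η-r σ-η σ-σ public

record RMod (P : RMonad) : Set₁ where
  open RMonad P
  field
    M     : Set → PO
    ς     : ∀ {X Y : Set} → (X → Car (T Y)) → M X ⇒ M Y
    ς-cong : ∀ {X Y : Set} {f g : X → Car (T Y)} → (∀ x → f x ≡ g x) → ∀ m → fun (ς f) m ≡ fun (ς g) m
    ς-η   : ∀ {X : Set} (m : Car (M X)) → fun (ς η) m ≡ m
    ς-σ   : ∀ {X Y Z : Set} (f : X → Car (T Y)) (g : Y → Car (T Z)) m →
            fun (ς g) (fun (ς f) m) ≡ fun (ς (fun (σ g) ∘ f)) m

record RModMor {P : RMonad} (M N : RMod P) : Set₁ where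
  open RMonad P
  private
    module M = RMod M
    module N = RMod N
  field
    ρ     : ∀ X → M.M X ⇒ N.M X
    ρ-nat : ∀ {X Y : Set} (f : X → Car (T Y)) m → fun (ρ Y) (fun (M.ς f) m) ≡ fun (N.ς f) (fun (ρ X) m)

_≈RMod_ : {P : RMonad} {M N : RMod P} → RModMor M N → RModMor M N → Set₁
_≈RMod_ {M = M} a b = ∀ X (m : Car (RMod.M M X)) → fun (RModMor.ρ a X) m ≡ fun (RModMor.ρ b X) m

compRMod : {P : RMonad} {L M N : RMod P} → RModMor M N → RModMor L M → RModMor L N
compRMod {L = L} {M} {N} b a = record
  { ρ = λ X → record { fun = λ m → fun (B.ρ X) (fun (A.ρ X) m) ; mono = λ le → mono (B.ρ X) (mono (A.ρ X) le) }
  ; ρ-nat = λ f m → trans (cong (fun (B.ρ _)) (A.ρ-nat f m)) (B.ρ-nat f (fun (A.ρ _) m))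
  }
  where
  module A = RModMor a
  module B = RModMor b

rtaut : (P : RMonad) → RMod P
rtaut P = record
  { M = T ; ς = σ ; ς-cong = σ-cong ; ς-η = σ-η ; ς-σ = σ-σ }
  where open RMonad P

rpull : {P Q : RMonad} → RMonadMor P Q → RMod Q → RMod P
rpull {P} {Q} h N = record
  { M = N.M
  ; ς = λ f → N.ς (fun (H.τ _) ∘ f)
  ; ς-cong = λ e → N.ς-cong (λ x → cong (fun (H.τ _)) (e x))
  ; ς-η = λ m → trans (N.ς-cong H.τ-η m) (N.ς-η m)
  ; ς-σ = λ f g m → trans (N.ς-σ (fun (H.τ _) ∘ f) (fun (H.τ _) ∘ g) m)
                         (N.ς-cong (λ x → sym (H.τ-σ g (f x))) m)
  }
  where
  module N = RMod N
  module H = RMonadMor h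

rpullMor : {P Q : RMonad} (h : RMonadMor P Q) {M N : RMod Q} → RModMor M N → RModMor (rpull h M) (rpull h N)
rpullMor h a = record { ρ = RModMor.ρ a ; ρ-nat = λ f m → RModMor.ρ-nat a _ m }

rtautMor : {P Q : RMonad} (h : RMonadMor P Q) → RModMor (rtaut P) (rpull h (rtaut Q))
rtautMor h = record { ρ = RMonadMor.τ h ; ρ-nat = RMonadMor.τ-σ h }

rderivN : {P : RMonad} → ℕ → RMod P → RMod P
rderivN {P} n N = record
  { M = λ X → N.M (ext n X)
  ; ς = λ f → N.ς (shiftN n f)
  ; ς-cong = λ e → N.ς-cong (shiftN-cong n e)
  ; ς-η = λ m → trans (N.ς-cong (shiftN-η n) m) (N.ς-η m)
  ; ς-σ = λ f g m → trans (N.ς-σ (shiftN n f) (shiftN n g) m) (N.ς-cong (shiftN-bind n f g) m)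
  }
  where
  module N = RMod N
  open RMonadKit P

roneMod : {P : RMonad} → RMod P
roneMod = record
  { M = λ _ → ⊤PO ; ς = λ _ → record { fun = λ _ → tt ; mono = λ _ → tt }
  ; ς-cong = λ _ _ → refl ; ς-η = λ _ → refl ; ς-σ = λ _ _ _ → refl }

_×RMod_ : {P : RMonad} → RMod P → RMod P → RMod P
A ×RMod B = record
  { M = λ X → A.M X ×PO B.M X
  ; ς = λ f → record { fun = λ p → fun (A.ς f) (proj₁ p) , fun (B.ς f) (proj₂ p)
                     ; mono = λ le → mono (A.ς f) (proj₁ le) , mono (B.ς f) (proj₂ le) }
  ; ς-cong = λ e p → cong₂ _,_ (A.ς-cong e (proj₁ p)) (B.ς-cong e (proj₂ p))
  ; ς-η = λ p → cong₂ _,_ (A.ς-η (proj₁ p)) (B.ς-η (proj₂ p))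
  ; ς-σ = λ f g p → cong₂ _,_ (A.ς-σ f g (proj₁ p)) (B.ς-σ f g (proj₂ p))
  }
  where
  module A = RMod A
  module B = RMod B

rpow : {P : RMonad} → RMod P → Arity → RMod P
rpow N []      = roneMod
rpow N (n ∷ s) = rderivN n N ×RMod rpow N s

rpowMor : {P Q : RMonad} (h : RMonadMor P Q) (s : Arity) → RModMor (rpow (rtaut P) s) (rpull h (rpow (rtaut Q) s))
rpowMor h [] = record { ρ = λ _ → record { fun = λ _ → tt ; mono = λ _ → tt } ; ρ-nat = λ _ _ → refl }
rpowMor {P} {Q} h (n ∷ s) = record
  { ρ = λ X → record
      { fun = λ p → fun (H.τ (ext n X)) (proj₁ p) , fun (RModMor.ρ rest X) (proj₂ p)
      ; mono = λ le → mono (H.τ (ext n X)) (proj₁ le) , mono (RModMor.ρ rest X) (proj₂ le) }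
  ; ρ-nat = λ f p → cong₂ _,_
      (trans (H.τ-σ (RMonadKit.shiftN P n f) (proj₁ p))
             (Q.σ-cong (KM.τ-shiftN n f) (fun (H.τ _) (proj₁ p))))
      (RModMor.ρ-nat rest f (proj₂ p))
  }
  where
  module H = RMonadMor h
  module P = RMonad P
  module Q = RMonad Q
  rest = rpowMor h s
  module KM = KitMor (λ X → Car (P.T X)) P.η (λ f → fun (P.σ f))
                     (λ X → Car (Q.T X)) Q.η (λ f → fun (Q.σ f)) Q.σ-cong
                     (λ {X} → fun (H.τ X)) H.τ-σ H.τ-η

powMor-id : {P : Monad} (s : Arity) → ∀ X x → ModMor.ρ (powMor (idMonadMor P) s) X x ≡ x
powMor-id []      X x = refl
powMor-id (n ∷ s) X p = cong (proj₁ p ,_) (powMor-id s X (proj₂ p))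

powMor-comp : {P Q R : Monad} (g : MonadMor Q R) (f : MonadMor P Q) (s : Arity) → ∀ X x →
  ModMor.ρ (powMor (compMonadMor g f) s) X x ≡ ModMor.ρ (powMor g s) X (ModMor.ρ (powMor f s) X x)
powMor-comp g f []      X x = refl
powMor-comp g f (n ∷ s) X p = cong (_ ,_) (powMor-comp g f s X (proj₂ p))

rpowMor-id : {P : RMonad} (s : Arity) → ∀ X x → fun (RModMor.ρ (rpowMor (idRMonadMor P) s) X) x ≡ x
rpowMor-id []      X x = refl
rpowMor-id (n ∷ s) X p = cong (proj₁ p ,_) (rpowMor-id s X (proj₂ p))

rpowMor-comp : {P Q R : RMonad} (g : RMonadMor Q R) (f : RMonadMor P Q) (s : Arity) → ∀ X x →
  fun (RModMor.ρ (rpowMor (compRMonadMor g f) s) X) x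
    ≡ fun (RModMor.ρ (rpowMor g s) X) (fun (RModMor.ρ (rpowMor f s) X) x)
rpowMor-comp g f []      X x = refl
rpowMor-comp g f (n ∷ s) X p = cong (_ ,_) (rpowMor-comp g f s X (proj₂ p))

record Sig : Set₁ where
  field
    I  : Set
    ar : I → Arity
open Sig public

record Rep (S : Sig) : Set₁ where
  field
    mon : Monad
    rep : (i : I S) → ModMor (pow (taut mon) (ar S i)) (taut mon)

record RepHom {S : Sig} (P Q : Rep S) : Set₁ where
  private
    module P = Rep P
    module Q = Rep Q
  field
    mor  : MonadMor P.mon Q.mon
    comm : ∀ i → compMod (tautMor mor) (P.rep i)
                   ≈Mod compMod (pullMor mor (Q.rep i)) (powMor mor (ar S i))

record RepΔ (S : Sig) : Set₁ where
  field
    mon : RMonad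
    rep : (i : I S) → RModMor (rpow (rtaut mon) (ar S i)) (rtaut mon)

record RepΔHom {S : Sig} (P Q : RepΔ S) : Set₁ where
  private
    module P = RepΔ P
    module Q = RepΔ Q
  field
    mor  : RMonadMor P.mon Q.mon
    comm : ∀ i → compRMod (rtautMor mor) (P.rep i)
                   ≈RMod compRMod (rpullMor mor (Q.rep i)) (rpowMor mor (ar S i))

record Cat : Set₂ where
  infix  4 _≈_
  infixr 9 _∘C_
  field
    Obj   : Set₁
    Hom   : Obj → Obj → Set₁
    _≈_   : ∀ {A B} → Hom A B → Hom A B → Set₁
    idC   : ∀ {A} → Hom A A
    _∘C_  : ∀ {A B C} → Hom B C → Hom A B → Hom A C
    ≈-refl  : ∀ {A B} {f : Hom A B} → f ≈ f
    ≈-sym   : ∀ {A B} {f g : Hom A B} → f ≈ g → g ≈ f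
    ≈-trans : ∀ {A B} {f g h : Hom A B} → f ≈ g → g ≈ h → f ≈ h
    ∘-resp  : ∀ {A B C} {f f' : Hom B C} {g g' : Hom A B} → f ≈ f' → g ≈ g' → f ∘C g ≈ f' ∘C g'
    idˡ   : ∀ {A B} {f : Hom A B} → idC ∘C f ≈ f
    idʳ   : ∀ {A B} {f : Hom A B} → f ∘C idC ≈ f
    assoc : ∀ {A B C D} {f : Hom C D} {g : Hom B C} {h : Hom A B} → (f ∘C g) ∘C h ≈ f ∘C (g ∘C h)

record Functor (C D : Cat) (F₀ : Cat.Obj C → Cat.Obj D) : Set₁ where
  private
    module C = Cat C
    module D = Cat D
  field
    F₁     : ∀ {A B} → C.Hom A B → D.Hom (F₀ A) (F₀ B)
    F-resp : ∀ {A B} {f g : C.Hom A B} → f C.≈ g → F₁ f D.≈ F₁ g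
    F-id   : ∀ {A} → F₁ (C.idC {A}) D.≈ D.idC
    F-∘    : ∀ {A B E} (g : C.Hom B E) (f : C.Hom A B) → F₁ (g C.∘C f) D.≈ F₁ g D.∘C F₁ f

record Adjunction (C D : Cat) {F₀ : Cat.Obj C → Cat.Obj D} {G₀ : Cat.Obj D → Cat.Obj C}
                  (F : Functor C D F₀) (G : Functor D C G₀) : Set₁ where
  private
    module C = Cat C
    module D = Cat D
    module F = Functor F
    module G = Functor G
  field
    φ      : ∀ {A B} → D.Hom (F₀ A) B → C.Hom A (G₀ B)
    ψ      : ∀ {A B} → C.Hom A (G₀ B) → D.Hom (F₀ A) B
    φ-resp : ∀ {A B} {f g : D.Hom (F₀ A) B} → f D.≈ g → φ f C.≈ φ g
    ψ-resp : ∀ {A B} {f g : C.Hom A (G₀ B)} → f C.≈ g → ψ f D.≈ ψ g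
    φψ     : ∀ {A B} (f : C.Hom A (G₀ B)) → φ (ψ f) C.≈ f
    ψφ     : ∀ {A B} (f : D.Hom (F₀ A) B) → ψ (φ f) D.≈ f
    φ-nat  : ∀ {A A' B B'} (k : C.Hom A' A) (g : D.Hom B B') (h : D.Hom (F₀ A) B) →
             φ (g D.∘C (h D.∘C F.F₁ k)) C.≈ G.F₁ g C.∘C (φ h C.∘C k)

idRepHom : {S : Sig} (P : Rep S) → RepHom P P
idRepHom {S} P = record
  { mor = idMonadMor (Rep.mon P)
  ; comm = λ i X x → cong (ModMor.ρ (Rep.rep P i) X) (sym (powMor-id (ar S i) X x)) }

compRepHom : {S : Sig} {P Q R : Rep S} → RepHom Q R → RepHom P Q → RepHom P R
compRepHom {S} {P} {Q} {R} g f = record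
  { mor = compMonadMor (RepHom.mor g) (RepHom.mor f)
  ; comm = λ i X x →
      trans (cong (MonadMor.τ (RepHom.mor g) X) (RepHom.comm f i X x))
      (trans (RepHom.comm g i X _)
             (cong (ModMor.ρ (Rep.rep R i) X) (sym (powMor-comp (RepHom.mor g) (RepHom.mor f) (ar S i) X x))))
  }

RepCat : Sig → Cat
RepCat S = record
  { Obj = Rep S
  ; Hom = RepHom
  ; _≈_ = λ a b → ∀ X t → MonadMor.τ (RepHom.mor a) X t ≡ MonadMor.τ (RepHom.mor b) X t
  ; idC = idRepHom _
  ; _∘C_ = compRepHom
  ; ≈-refl = λ X t → refl
  ; ≈-sym = λ e X t → sym (e X t)
  ; ≈-trans = λ e e' X t → trans (e X t) (e' X t)
  ; ∘-resp = λ {f' = f'} {g} e e' X t → trans (e X _) (cong (MonadMor.τ (RepHom.mor f') X) (e' X t))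
  ; idˡ = λ X t → refl
  ; idʳ = λ X t → refl
  ; assoc = λ X t → refl
  }

idRepΔHom : {S : Sig} (P : RepΔ S) → RepΔHom P P
idRepΔHom {S} P = record
  { mor = idRMonadMor (RepΔ.mon P)
  ; comm = λ i X x → cong (fun (RModMor.ρ (RepΔ.rep P i) X)) (sym (rpowMor-id (ar S i) X x)) }

compRepΔHom : {S : Sig} {P Q R : RepΔ S} → RepΔHom Q R → RepΔHom P Q → RepΔHom P R
compRepΔHom {S} {P} {Q} {R} g f = record
  { mor = compRMonadMor (RepΔHom.mor g) (RepΔHom.mor f)
  ; comm = λ i X x →
      trans (cong (fun (RMonadMor.τ (RepΔHom.mor g) X)) (RepΔHom.comm f i X x))
      (trans (RepΔHom.comm g i X _)
             (cong (fun (RModMor.ρ (RepΔ.rep R i) X))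
                   (sym (rpowMor-comp (RepΔHom.mor g) (RepΔHom.mor f) (ar S i) X x))))
  }

RepΔCat : Sig → Cat
RepΔCat S = record
  { Obj = RepΔ S
  ; Hom = RepΔHom
  ; _≈_ = λ a b → ∀ X t → fun (RMonadMor.τ (RepΔHom.mor a) X) t ≡ fun (RMonadMor.τ (RepΔHom.mor b) X) t
  ; idC = idRepΔHom _
  ; _∘C_ = compRepΔHom
  ; ≈-refl = λ X t → refl
  ; ≈-sym = λ e X t → sym (e X t)
  ; ≈-trans = λ e e' X t → trans (e X t) (e' X t)
  ; ∘-resp = λ {f' = f'} {g} e e' X t → trans (e X _) (cong (fun (RMonadMor.τ (RepΔHom.mor f') X)) (e' X t))
  ; idˡ = λ X t → refl
  ; idʳ = λ X t → refl
  ; assoc = λ X t → refl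
  }

ΔMon : Monad → RMonad
ΔMon Q = record
  { T = λ X → Δ (T X)
  ; η = η
  ; σ = λ f → record { fun = σ f ; mono = cong (σ f) }
  ; σ-cong = σ-cong ; σ-η-r = σ-η-r ; σ-η = σ-η ; σ-σ = σ-σ }
  where open Monad Q

module _ (Q : Monad) where
  private
    module Q = Monad Q
    RP = λ s → RMod.M (rpow (rtaut (ΔMon Q)) s)
    SP = λ s → Mod.M (pow (taut Q) s)

  ΔconvPow : ∀ s X → Car (RP s X) → SP s X
  ΔconvPow []      X _ = tt
  ΔconvPow (n ∷ s) X p = proj₁ p , ΔconvPow s X (proj₂ p)

  ΔconvPow-mono : ∀ s X {x y} → PO._⊑_ (RP s X) x y → ΔconvPow s X x ≡ ΔconvPow s X y
  ΔconvPow-mono []      X le = refl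
  ΔconvPow-mono (n ∷ s) X le = cong₂ _,_ (proj₁ le) (ΔconvPow-mono s X (proj₂ le))

  ΔconvPow-nat : ∀ s {X Y : Set} (f : X → Q.T Y) x →
    ΔconvPow s Y (fun (RMod.ς (rpow (rtaut (ΔMon Q)) s) f) x) ≡ Mod.ς (pow (taut Q) s) f (ΔconvPow s X x)
  ΔconvPow-nat []      f x = refl
  ΔconvPow-nat (n ∷ s) f p = cong (_ ,_) (ΔconvPow-nat s f (proj₂ p))

ΔRep : {S : Sig} → Rep S → RepΔ S
ΔRep {S} Q = record
  { mon = ΔMon (Rep.mon Q)
  ; rep = λ i → record
      { ρ = λ X → record
          { fun = λ x → ModMor.ρ (Rep.rep Q i) X (ΔconvPow (Rep.mon Q) (ar S i) X x)
          ; mono = λ le → cong (ModMor.ρ (Rep.rep Q i) X) (ΔconvPow-mono (Rep.mon Q) (ar S i) X le) }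
      ; ρ-nat = λ f x → trans (cong (ModMor.ρ (Rep.rep Q i) _) (ΔconvPow-nat (Rep.mon Q) (ar S i) f x))
                              (ModMor.ρ-nat (Rep.rep Q i) f _) }
  }

barMon : RMonad → Monad
barMon R = record
  { T = λ X → Car (T X)
  ; η = η
  ; σ = λ f → fun (σ f)
  ; σ-cong = σ-cong ; σ-η-r = σ-η-r ; σ-η = σ-η ; σ-σ = σ-σ }
  where open RMonad R

module _ (R : RMonad) where
  private
    RP = λ s → RMod.M (rpow (rtaut R) s)
    SP = λ s → Mod.M (pow (taut (barMon R)) s)

  UconvPow : ∀ s X → SP s X → Car (RP s X)
  UconvPow []      X _ = tt
  UconvPow (n ∷ s) X p = proj₁ p , UconvPow s X (proj₂ p)

  UconvPow-nat : ∀ s {X Y : Set} (f : X → Car (RMonad.T R Y)) x →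
    UconvPow s Y (Mod.ς (pow (taut (barMon R)) s) f x) ≡ fun (RMod.ς (rpow (rtaut R) s) f) (UconvPow s X x)
  UconvPow-nat []      f x = refl
  UconvPow-nat (n ∷ s) f p = cong (_ ,_) (UconvPow-nat s f (proj₂ p))

URep : {S : Sig} → RepΔ S → Rep S
URep {S} R = record
  { mon = barMon (RepΔ.mon R)
  ; rep = λ i → record
      { ρ = λ X x → fun (RModMor.ρ (RepΔ.rep R i) X) (UconvPow (RepΔ.mon R) (ar S i) X x)
      ; ρ-nat = λ f x → trans (cong (fun (RModMor.ρ (RepΔ.rep R i) _)) (UconvPow-nat (RepΔ.mon R) (ar S i) f x))
                              (RModMor.ρ-nat (RepΔ.rep R i) f _) }
  }

-- A monotone map out of a discrete preorder Δ X is just a function on X, so a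
-- monad morphism Δ A → B is the same data as a monad morphism A → B̄ (B̄ keeps
-- the unit and substitution of B), and likewise for the induced maps on every
-- arity power; the representation squares correspond because the conversions
-- between Set-valued and PO-valued arity powers commute with these maps. The
-- endomonad underlying Δ A is A itself, so the unit of the adjunction has
-- identity components and both transpositions leave the components unchanged.

module Submission where

open import Defs
open import Data.Product using (Σ; _×_; _,_; proj₁; proj₂)
open import Data.List using (_∷_; [])
open import Relation.Binary.PropositionalEquality

Δ-extend : {X : Set} (B : PO) → (X → Car B) → Δ X ⇒ B
Δ-extend B f = record { fun = f ; mono = λ { refl → PO.⊑-refl B } }

UMonadMor : {P Q : RMonad} → RMonadMor P Q → MonadMor (barMon P) (barMon Q)
UMonadMor g = record
  { τ = λ X → fun (RMonadMor.τ g X) ; τ-σ = RMonadMor.τ-σ g ; τ-η = RMonadMor.τ-η g }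

transposeΔ : {A : Monad} {B : RMonad} → MonadMor A (barMon B) → RMonadMor (ΔMon A) B
transposeΔ {B = B} k = record
  { τ = λ X → Δ-extend (RMonad.T B X) (MonadMor.τ k X)
  ; τ-σ = MonadMor.τ-σ k ; τ-η = MonadMor.τ-η k }

ΔconvPow-UconvPow : (A : Monad) (s : Arity) → ∀ X y → ΔconvPow A s X (UconvPow (ΔMon A) s X y) ≡ y
ΔconvPow-UconvPow A []      X y = refl
ΔconvPow-UconvPow A (n ∷ s) X y = cong (proj₁ y ,_) (ΔconvPow-UconvPow A s X (proj₂ y))

UconvPow-powMor : {P Q : RMonad} (g : RMonadMor P Q) (s : Arity) → ∀ X y →
  UconvPow Q s X (ModMor.ρ (powMor (UMonadMor g) s) X y) ≡ fun (RModMor.ρ (rpowMor g s) X) (UconvPow P s X y)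
UconvPow-powMor g []      X y = refl
UconvPow-powMor g (n ∷ s) X y = cong (_ ,_) (UconvPow-powMor g s X (proj₂ y))

UconvPow-powMor-ΔconvPow : {A : Monad} {B : RMonad} (k : MonadMor A (barMon B)) (s : Arity) → ∀ X x →
  UconvPow B s X (ModMor.ρ (powMor k s) X (ΔconvPow A s X x)) ≡ fun (RModMor.ρ (rpowMor (transposeΔ k) s) X) x
UconvPow-powMor-ΔconvPow k []      X x = refl
UconvPow-powMor-ΔconvPow k (n ∷ s) X x = cong (_ ,_) (UconvPow-powMor-ΔconvPow k s X (proj₂ x))

module _ {S : Sig} where

  URepHom : {P Q : RepΔ S} → RepΔHom P Q → RepHom (URep P) (URep Q)
  URepHom {P} {Q} g = record
    { mor = UMonadMor (RepΔHom.mor g)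
    ; comm = λ i X y → begin
        fun (RMonadMor.τ g' X) (fun (ρP i X) (UconvPow (RepΔ.mon P) (ar S i) X y))
          ≡⟨ RepΔHom.comm g i X _ ⟩
        fun (ρQ i X) (fun (RModMor.ρ (rpowMor g' (ar S i)) X) (UconvPow (RepΔ.mon P) (ar S i) X y))
          ≡⟨ cong (fun (ρQ i X)) (UconvPow-powMor g' (ar S i) X y) ⟨
        fun (ρQ i X) (UconvPow (RepΔ.mon Q) (ar S i) X (ModMor.ρ (powMor (UMonadMor g') (ar S i)) X y)) ∎ }
    where
    open ≡-Reasoning
    g' = RepΔHom.mor g
    ρP = λ i → RModMor.ρ (RepΔ.rep P i)
    ρQ = λ i → RModMor.ρ (RepΔ.rep Q i)

  transposeRep : {A : Rep S} {B : RepΔ S} → RepHom A (URep B) → RepΔHom (ΔRep A) B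
  transposeRep {A} {B} k = record
    { mor = transposeΔ k'
    ; comm = λ i X x → begin
        MonadMor.τ k' X (ModMor.ρ (Rep.rep A i) X (ΔconvPow (Rep.mon A) (ar S i) X x))
          ≡⟨ RepHom.comm k i X _ ⟩
        fun (ρB i X) (UconvPow (RepΔ.mon B) (ar S i) X (ModMor.ρ (powMor k' (ar S i)) X (ΔconvPow (Rep.mon A) (ar S i) X x)))
          ≡⟨ cong (fun (ρB i X)) (UconvPow-powMor-ΔconvPow k' (ar S i) X x) ⟩
        fun (ρB i X) (fun (RModMor.ρ (rpowMor (transposeΔ k') (ar S i)) X) x) ∎ }
    where
    open ≡-Reasoning
    k' = RepHom.mor k
    ρB = λ i → RModMor.ρ (RepΔ.rep B i)

  unitRep : (A : Rep S) → RepHom A (URep (ΔRep A))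
  unitRep A = record
    { mor = idMonadMor (Rep.mon A)
    ; comm = λ i X y → cong (ModMor.ρ (Rep.rep A i) X) (sym (begin
        ΔconvPow (Rep.mon A) (ar S i) X (UconvPow (ΔMon (Rep.mon A)) (ar S i) X (ModMor.ρ (powMor (idMonadMor (Rep.mon A)) (ar S i)) X y))
          ≡⟨ ΔconvPow-UconvPow (Rep.mon A) (ar S i) X _ ⟩
        ModMor.ρ (powMor (idMonadMor (Rep.mon A)) (ar S i)) X y
          ≡⟨ powMor-id (ar S i) X y ⟩
        y ∎)) }
    where open ≡-Reasoning

  ΔRepHom : {P Q : Rep S} → RepHom P Q → RepΔHom (ΔRep P) (ΔRep Q)
  ΔRepHom {Q = Q} f = transposeRep (compRepHom (unitRep Q) f)

module _ (S : Sig) where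

  ΔFunctor : Functor (RepCat S) (RepΔCat S) ΔRep
  ΔFunctor = record
    { F₁ = ΔRepHom ; F-resp = λ e → e ; F-id = λ X t → refl ; F-∘ = λ g f X t → refl }

  UFunctor : Functor (RepΔCat S) (RepCat S) URep
  UFunctor = record
    { F₁ = URepHom ; F-resp = λ e → e ; F-id = λ X t → refl ; F-∘ = λ g f X t → refl }

  ΔU-adjunction : Adjunction (RepCat S) (RepΔCat S) ΔFunctor UFunctor
  ΔU-adjunction = record
    { φ = λ {A} h → compRepHom (URepHom h) (unitRep A)
    ; ψ = transposeRep
    ; φ-resp = λ e → e
    ; ψ-resp = λ e → e
    ; φψ = λ f X t → refl
    ; ψφ = λ f X t → refl
    ; φ-nat = λ k g h X t → refl }

lemma2p11 : (S : Sig) →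
    Σ (Functor (RepCat S) (RepΔCat S) ΔRep) λ F →
    Σ (Functor (RepΔCat S) (RepCat S) URep) λ G →
    (∀ {P Q : Rep S} (f : RepHom P Q) X x →
    fun (RMonadMor.τ (RepΔHom.mor (Functor.F₁ F f)) X) x ≡ MonadMor.τ (RepHom.mor f) X x)
    × (∀ {P Q : RepΔ S} (g : RepΔHom P Q) X x →
    MonadMor.τ (RepHom.mor (Functor.F₁ G g)) X x ≡ fun (RMonadMor.τ (RepΔHom.mor g) X) x)
    × Adjunction (RepCat S) (RepΔCat S) F G
lemma2p11 S = ΔFunctor S , UFunctor S , (λ f X x → refl) , (λ g X x → refl) , ΔU-adjunction S
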